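{- Let $(U,\mathcal{D})$ be a flexible tight interdependent orbit union with $\mathcal{D}=\{D_1,\dots,D_m\}$, $m\ge 3$, and let $n$ with $3\le n\le m$ and indices $s\le t$, $r$ be such that: (i) $\{D_1,\dots,D_{n-1}\}$ is (the vertex set of) a connected component of the graph $\mathcal{O}(U,\mathcal{D})-D_n$; (ii) the orbits directly interdependent with $D_n$ are exactly $D_s,\dots,D_{n-1}$ and $D_r,\dots,D_m$ (where $s\le n-1$, and $r>m$ means there are none of the latter kind); (iii) the orbits among $D_1,\dots,D_{n-1}$ that contain a nontrivial order-autonomous antichain of the ordered subset $U':=U\setminus\bigcup_{i=n}^m D_i$ are exactly $D_t,\dots,D_{n-1}$. For $j\in\{s,\dots,n-1\}$ let $A^j_1,\dots,A^j_{\ell_j}$ be the inclusion-maximal $U'$-order-autonomous antichains contained in $D_j$ (they partition $D_j$), and fix $a^j_i\in A^j_i$. Put $$U_n:=\bigcup_{i=1}^{s-1}D_i\cup\bigcup_{j=s}^{n-1}\{a^j_1,\dots,a^j_{\ell_j}\},\qquad \mathcal{D}_n:=\{D_j\cap U_n: 1\le j\le n-1\}.$$ For $\Phi\in\mathrm{Aut}_{\mathcal{D}}(U)$ define $\Phi_n:U_n\to U_n$ by $\Phi_n(x)=\Phi(x)$ for $x\in\bigcup_{i=1}^{s-1}D_i$, and $\Phi_n(a^j_i):=a^j_k$ where $k$ is such that $\Phi(a^j_i)\in A^j_k$. Let $Q:=\bigcup_{j=s}^m D_j$ (as an ordered subset of $U$), let $\mathcal{E}_Q:=\{A^j_i: s\le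 j\le n-1,\ 1\le i\le\ell_j\}\cup\{D_n,\dots,D_m\}$, and let $\mathcal{D}_Q$ be the set of all $\mathrm{Aut}_{\mathcal{E}_Q}(Q)$-orbits. Let $\mathrm{Aut}^U_{\mathcal{D}_Q}(Q):=\{\Psi\in\mathrm{Aut}_{\mathcal{D}}(U):\Psi_n=\mathrm{id}_{U_n}\}$. Then $\mathrm{Aut}^U_{\mathcal{D}_Q}(Q)$ is a normal subgroup of $\mathrm{Aut}_{\mathcal{D}}(U)$, the factor group $\mathrm{Aut}_{\mathcal{D}}(U)/\mathrm{Aut}^U_{\mathcal{D}_Q}(Q)$ is isomorphic to a subgroup of $\mathrm{Aut}_{\mathcal{D}_n}(U_n)$, and consequently $$|\mathrm{Aut}_{\mathcal{D}}(U)|\le|\mathrm{Aut}_{\mathcal{D}_n}(U_n)|\cdot|\mathrm{Aut}_{\mathcal{D}_Q}(Q)|.$$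
   Context: Ordered sets are finite; $\mathrm{Aut}(P)$ is the automorphism group. For $B,T\subseteq P$, $B<T$ means $b<t$ for all $b\in B,t\in T$. A nonempty $A\subseteq P$ is order-autonomous iff for all $z\in P\setminus A$: if $z<a$ for some $a\in A$ then $z<A$, and if $z>a$ for some $a\in A$ then $z>A$; it is nontrivial iff $|A|\notin\{1,|P|\}$. Width $w(P)$ = largest antichain size. Rank: minimal elements have rank $0$; $x$ has rank $k$ iff it is minimal in $P\setminus\{z:\mathrm{rank}(z)\le k-1\}$; $R_k$ is the set of elements of rank $k$; $\alpha(R_k)$ is the number of distinct restrictions $\Phi|_{R_k}$, $\Phi\in\mathrm{Aut}(P)$. $P$ is coconnected iff there is no partition $P=B\cup T$ into nonempty sets with $B<T$. A coconnected ordered set $P$ of width $w$ in which no element is fixed by all automorphisms is max-locked iff either $w\ge3$, $w\ne4$ and $\alpha(R_k)\ge(w-1)!$ for some $k$, or $w=4$ and $\alpha(R_k)>8$ for some $k$; coconnected ordered sets of width $2$ with exactly $2$ automorphisms are also called max-locked. A dictated orbit structure for $P$ is a partition $\mathcal{D}$ of $P$ into antichains; $(P,\mathcal{D})$ is a structured ordered set. $\mathrm{Aut}_{\mathcal{D}}(P)$ is the group of automorphisms $\Phi$ of $P$ such that every orbit of the cyclic group $\langle\Phi\rangle$ lies inside one member of $\mathcal{D}$; its orbits are the $\mathcal{D}$-orbits. For $\mathcal{D}$-orbits $C,D$ write $C\upharpoonleft D$ iff there are $c_1\in C,d_1\in D$ with $c_1<d_1$ and $c_2\in C,d_2\in D$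 that are incomparable; $C,D$ are directly interdependent iff $C\upharpoonleft D$ or $D\upharpoonleft C$. The orbit graph $\mathcal{O}(P,\mathcal{D})$ has the $\mathcal{D}$-orbits as vertices, adjacent iff directly interdependent. $(P,\mathcal{D})$ is an interdependent orbit union iff $\mathcal{O}(P,\mathcal{D})$ is connected; it is without slack iff no member of $\mathcal{D}$ contains a nontrivial order-autonomous antichain of $P$; tight iff without slack and $\mathrm{Aut}_{\mathcal{D}}(P)$ acts transitively on each member of $\mathcal{D}$ (so the members of $\mathcal{D}$ are the $\mathcal{D}$-orbits); flexible iff it is an interdependent orbit union, $P$ is not max-locked, and $|P|>1$. -}

module Defs where

open import Level using (0ℓ)
open import Data.Nat using (ℕ; zero; suc; _+_; _*_; _∸_; _≤_; _<_; _≤?_; _<?_; _!)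
open import Data.Fin using (Fin)
open import Data.Fin.Properties using () renaming (_≟_ to _≟F_)
open import Data.Vec using (Vec; lookup; tabulate)
open import Data.List using (List; length)
open import Data.List.Relation.Unary.Unique.Propositional using (Unique)
open import Data.List.Relation.Unary.AllPairs using (AllPairs)
open import Data.List.Relation.Unary.All using (All)
open import Data.List.Relation.Unary.Any using (Any)
open import Data.List.Membership.Propositional using (_∈_)
open import Data.Product using (Σ; ∃; _×_; _,_)
open import Data.Sum using (_⊎_)
open import Data.Bool using (Bool; T; if_then_else_; _∧_)
open import Data.Unit using (⊤)
open import Data.Empty using (⊥)
open import Relation.Nullary using (¬_; does)
open import Relation.Binary using (Rel; IsPartialOrder)
open import Relation.Binary.PropositionalEquality using (_≡_; _≢_)
open import Relation.Binary.Construct.Closure.ReflexiveTransitive using (Star)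
open import Function.Bundles using (_⇔_)

record FinPoset : Set₁ where
  field
    N : ℕ
    _≼_ : Rel (Fin N) 0ℓ
    isPartialOrder : IsPartialOrder _≡_ _≼_

open FinPoset public

-- Maps Fin N → Fin N, tabulated (so that equality is first-order).
-- An automorphism of an ordered subset S is represented by the map that
-- acts as the automorphism on S and as the identity outside S.
Map : ℕ → Set
Map N = Vec (Fin N) N

app : ∀ {N} → Map N → Fin N → Fin N
app f x = lookup f x

_⊙_ : ∀ {N} → Map N → Map N → Map N
f ⊙ g = tabulate (λ x → lookup f (lookup g x))

idMap : ∀ {N} → Map N
idMap = tabulate (λ x → x)

iter : ∀ {N} → Map N → ℕ → Fin N → Fin N
iter f zero x = x
iter f (suc k) x = app f (iter f k x)

InverseOf : ∀ {N} → Map N → Map N → Set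
InverseOf {N} g f = ∀ (x : Fin N) → (app g (app f x) ≡ x) × (app f (app g x) ≡ x)

BSub : ℕ → Set
BSub N = Fin N → Bool

HasSize : ∀ {N} → (Fin N → Set) → ℕ → Set
HasSize {N} A k = Σ (List (Fin N)) λ l →
  Unique l × (length l ≡ k) × (∀ x → (x ∈ l) ⇔ A x)

HasSizeM : ∀ {N} → (Map N → Set) → ℕ → Set
HasSizeM {N} G k = Σ (List (Map N)) λ l →
  Unique l × (length l ≡ k) × (∀ f → (f ∈ l) ⇔ G f)

Full : ∀ {N} → Fin N → Set
Full _ = ⊤

IsNormalSubgroup : ∀ {N} → (G K : Map N → Set) → Set
IsNormalSubgroup {N} G K =
  (∀ f → K f → G f) ×
  K idMap ×
  (∀ f g → K f → K g → K (f ⊙ g)) ×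
  (∀ f g → K f → InverseOf g f → K g) ×
  (∀ f g h → G f → InverseOf g f → K h → K (f ⊙ (h ⊙ g)))

module _ (P : FinPoset) where
  private
    n = N P
    _≼'_ = _≼_ P

  Lt : Fin n → Fin n → Set
  Lt x y = (x ≼' y) × (x ≢ y)

  Incomp : Fin n → Fin n → Set
  Incomp x y = (¬ (x ≼' y)) × (¬ (y ≼' x))

  Antichain : BSub n → Set
  Antichain A = ∀ x y → T (A x) → T (A y) → x ≼' y → x ≡ y

  Autonomous : (Fin n → Set) → BSub n → Set
  Autonomous S A =
    (∀ x → T (A x) → S x) ×
    (Σ (Fin n) λ a → T (A a)) ×
    (∀ z → S z → ¬ T (A z) →
       ((Σ (Fin n) λ a → T (A a) × Lt z a) → ∀ a → T (A a) → Lt z a) ×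
       ((Σ (Fin n) λ a → T (A a) × Lt a z) → ∀ a → T (A a) → Lt a z))

  NonTrivial : (Fin n → Set) → BSub n → Set
  NonTrivial S A = ∀ k → HasSize (λ x → T (A x)) k → (k ≢ 1) × ¬ HasSize S k

  IsAut : (Fin n → Set) → Map n → Set
  IsAut S f =
    (∀ x → S x → S (app f x)) ×
    (∀ x y → S x → S y → app f x ≡ app f y → x ≡ y) ×
    (∀ y → S y → Σ (Fin n) λ x → S x × (app f x ≡ y)) ×
    (∀ x y → S x → S y → (x ≼' y) ⇔ (app f x ≼' app f y)) ×
    (∀ x → ¬ S x → app f x ≡ x)

  -- Aut_D(S) where the dictated orbit structure D is given by the relation
  -- "same x y" = x and y lie in the same member of D
  AutD : (Fin n → Set) → (Fin n → Fin n → Set) → Map n → Set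
  AutD S same f = IsAut S f × (∀ k x → S x → same (iter f k x) x)

  IsWidth : ℕ → Set
  IsWidth w =
    (Σ (BSub n) λ A → Antichain A × HasSize (λ x → T (A x)) w) ×
    (∀ A k → Antichain A → HasSize (λ x → T (A x)) k → k ≤ w)

  -- Removed k x : x has rank ≤ k - 1
  Removed : ℕ → Fin n → Set
  Removed zero x = ⊥
  Removed (suc k) x =
    Removed k x ⊎ ((¬ Removed k x) × (∀ z → Lt z x → Removed k z))

  HasRank : ℕ → Fin n → Set
  HasRank k x = (¬ Removed k x) × (∀ z → Lt z x → Removed k z)

  AgreeOn : (Fin n → Set) → Map n → Map n → Set
  AgreeOn R f g = ∀ x → R x → app f x ≡ app g x

  HasAlpha : ℕ → ℕ → Set
  HasAlpha k a = Σ (List (Map n)) λ l →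
    (length l ≡ a) ×
    All (IsAut Full) l ×
    AllPairs (λ f g → ¬ AgreeOn (HasRank k) f g) l ×
    (∀ f → IsAut Full f → Any (AgreeOn (HasRank k) f) l)

  AlphaGE : ℕ → ℕ → Set
  AlphaGE k c = Σ ℕ λ a → HasAlpha k a × (c ≤ a)

  Coconnected : Set
  Coconnected = ¬ (Σ (BSub n) λ B →
    (Σ (Fin n) λ b → T (B b)) × (Σ (Fin n) λ t → ¬ T (B t)) ×
    (∀ b t → T (B b) → ¬ T (B t) → Lt b t))

  NoFixedPoint : Set
  NoFixedPoint = ∀ x → Σ (Map n) λ f → IsAut Full f × (app f x ≢ x)

  MaxLocked : Set
  MaxLocked = Coconnected × (Σ ℕ λ w → IsWidth w ×
    ((NoFixedPoint ×
       (((3 ≤ w) × (w ≢ 4) × (Σ ℕ λ k → AlphaGE k ((w ∸ 1) !))) ⊎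
        ((w ≡ 4) × (Σ ℕ λ k → AlphaGE k 9))))
     ⊎ ((w ≡ 2) × HasSizeM (IsAut Full) 2)))

  Upharp : (Fin n → Set) → (Fin n → Set) → Set
  Upharp C D =
    (Σ (Fin n) λ c → Σ (Fin n) λ d → C c × D d × Lt c d) ×
    (Σ (Fin n) λ c → Σ (Fin n) λ d → C c × D d × Incomp c d)

  DirInt : (Fin n → Set) → (Fin n → Set) → Set
  DirInt C D = Upharp C D ⊎ Upharp D C

  Orbit : (Fin n → Fin n → Set) → Fin n → Fin n → Set
  Orbit same x y = Σ (Map n) λ f → AutD Full same f × (app f x ≡ y)

  -- orbit graph connected: any two orbits joined by a path of directly
  -- interdependent orbits (orbits represented by elements)
  InterdepOrbitUnion : (Fin n → Fin n → Set) → Set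
  InterdepOrbitUnion same = ∀ x y →
    Star (λ a b → Orbit same a b ⊎ DirInt (Orbit same a) (Orbit same b)) x y

  -- Dictated orbit structure D = {D_1,…,D_m} given by a block index blk

  module _ (blk : Fin n → ℕ) where

    Dm : ℕ → Fin n → Set
    Dm i x = blk x ≡ i

    SameD : Fin n → Fin n → Set
    SameD x y = blk x ≡ blk y

    IsDictated : ℕ → Set
    IsDictated m =
      (∀ x → (1 ≤ blk x) × (blk x ≤ m)) ×
      (∀ i → 1 ≤ i → i ≤ m → Σ (Fin n) λ x → blk x ≡ i) ×
      (∀ x y → blk x ≡ blk y → x ≼' y → x ≡ y)

    WithoutSlack : Set
    WithoutSlack = ∀ i A → (∀ x → T (A x) → blk x ≡ i) → Antichain A →
      Autonomous Full A → ¬ NonTrivial Full A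

    Tight : Set
    Tight = WithoutSlack ×
      (∀ x y → blk x ≡ blk y → Σ (Map n) λ f → AutD Full SameD f × (app f x ≡ y))

    Flexible : Set
    Flexible = InterdepOrbitUnion SameD × (¬ MaxLocked) × (1 < n)

    DI : ℕ → ℕ → Set
    DI i j = DirInt (Dm i) (Dm j)

    EdgeWithout : ℕ → ℕ → ℕ → ℕ → Set
    EdgeWithout m k i j =
      ((1 ≤ i) × (i ≤ m) × (i ≢ k)) × ((1 ≤ j) × (j ≤ m) × (j ≢ k)) × DI i j

    MaxAutAC : (Fin n → Set) → ℕ → BSub n → Set
    MaxAutAC S j A =
      (∀ z → T (A z) → blk z ≡ j) × Antichain A × Autonomous S A ×
      (∀ B → (∀ z → T (B z) → blk z ≡ j) → Antichain B → Autonomous S B →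
        (∀ z → T (A z) → T (B z)) → ∀ z → T (B z) → T (A z))

    module _ (s nn : ℕ) where

      U' : Fin n → Set
      U' x = blk x < nn

      SameA : Fin n → Fin n → Set
      SameA x y = Σ (BSub n) λ A → MaxAutAC U' (blk x) A × T (A x) × T (A y)

      -- rep chooses a^j_i ∈ A^j_i (rep x = representative of x's class)
      IsRepChoice : (Fin n → Fin n) → Set
      IsRepChoice rep = ∀ x → s ≤ blk x → blk x < nn →
        SameA x (rep x) × (∀ y → SameA x y → rep y ≡ rep x)

      module _ (rep : Fin n → Fin n) where

        Un : Fin n → Set
        Un x = (blk x < s) ⊎ ((s ≤ blk x) × (blk x < nn) × (rep x ≡ x))

        SameDn : Fin n → Fin n → Set
        SameDn = SameD

        phiN : Map n → Fin n → Fin n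
        phiN Φ x =
          if does (blk x <? s) then app Φ x
          else if does (s ≤? blk x) ∧ does (blk x <? nn) ∧ does (rep x ≟F x)
               then rep (app Φ x) else x

        phiNMap : Map n → Map n
        phiNMap Φ = tabulate (phiN Φ)

        AutUDQ : Map n → Set
        AutUDQ Ψ = AutD Full SameD Ψ × (∀ x → Un x → phiN Ψ x ≡ x)

      Q : Fin n → Set
      Q x = s ≤ blk x

      -- E_Q = {A^j_i : s ≤ j ≤ nn-1} ∪ {D_nn, …, D_m}
      SameE : Fin n → Fin n → Set
      SameE x y = (blk x ≡ blk y) ×
        (((s ≤ blk x) × (blk x < nn) × SameA x y) ⊎ (nn ≤ blk x))

      SameDQ : Fin n → Fin n → Set
      SameDQ x y = Σ (Map n) λ Ψ → AutD Q SameE Ψ × (app Ψ x ≡ y)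

-- Restricting Φ ∈ Aut_D(U) to Uₙ (Φ on D_1,…,D_{s-1}, and the permutation Φ induces on the
-- classes A^j_i, read off through the representatives a^j_i) is a group homomorphism into
-- Aut_{Dₙ}(Uₙ). It is well defined because a D-automorphism maps maximal U'-autonomous
-- antichains of a block onto such antichains of the same block, and it preserves the order
-- because, by autonomy, an element outside A^j_i compares in the same way with all of A^j_i.
-- Its kernel Aut^U_{D_Q}(Q) is normal and the fibres are its cosets. A kernel element fixes
-- D_1,…,D_{s-1} pointwise and maps every A^j_i onto itself, so it is an Aut_{E_Q}(Q)-map and
-- all its powers are too; hence it lies in Aut_{D_Q}(Q), and counting cosets gives the bound.
module Submission where

open import Defs
open import Data.Nat using (ℕ; zero; suc; _+_; _*_; _≤_; _<_; _<?_; _≤?_; z≤n; s≤s)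
open import Data.Nat.Properties using (≤⇒≯; ≮⇒≥; ≰⇒>; <-trans)
open import Data.Fin using (Fin)
open import Data.Fin.Properties using (any?; _≟_)
open import Data.Product using (Σ; ∃; _×_; _,_; proj₁; proj₂; map₂; swap)
open import Data.Sum using (_⊎_; inj₁; inj₂; [_,_]′)
open import Data.Bool using (T; if_then_else_; _∨_)
open import Data.Bool.Properties using (T-∨)
open import Data.Unit using (tt)
open import Data.Empty using (⊥-elim)
open import Data.Vec using (lookup; tabulate)
open import Data.Vec.Properties using (lookup∘tabulate; tabulate∘lookup; tabulate-cong; ≡-dec)
open import Data.List using (List; []; _∷_; length; map; _++_; cartesianProduct)
open import Data.List.Properties using (length-++; length-map; length-removeAt′)
open import Data.List.Relation.Unary.Any using (here; there; index; _─_) renaming (any? to anyᴸ?; map to mapᴬ)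
open import Data.List.Relation.Unary.All using () renaming (lookup to lookupᴬ)
open import Data.List.Relation.Unary.AllPairs using (_∷_)
open import Data.List.Relation.Unary.Unique.Propositional using (Unique)
open import Data.List.Membership.Propositional using (_∈_; find)
open import Data.List.Membership.Propositional.Properties using (∈-cartesianProduct⁺)
open import Function using (_∘_)
open import Function.Bundles using (_⇔_; mk⇔; Equivalence)
open import Function.Construct.Composition using (_⇔-∘_)
open import Relation.Nullary using (¬_; Dec; does; yes; no)
open import Relation.Nullary.Decidable using (_×-dec_; _⊎-dec_)
open import Relation.Binary using (IsPartialOrder)
open import Relation.Binary.Construct.Closure.ReflexiveTransitive using (Star)
open import Relation.Binary.PropositionalEquality
  using (_≡_; _≢_; refl; sym; trans; cong; cong₂; subst; subst₂; module ≡-Reasoning)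

open Equivalence using (to; from)

if-does-yes : ∀ {P A : Set} (d : Dec P) {u v : A} → P → (if does d then u else v) ≡ u
if-does-yes (yes _) _ = refl
if-does-yes (no ¬p) p = ⊥-elim (¬p p)

if-does-no : ∀ {P A : Set} (d : Dec P) {u v : A} → ¬ P → (if does d then u else v) ≡ v
if-does-no (yes p) ¬p = ⊥-elim (¬p p)
if-does-no (no _) _ = refl

module _ {n : ℕ} where

  app-⊙ : (f g : Map n) (x : Fin n) → app (f ⊙ g) x ≡ app f (app g x)
  app-⊙ f g = lookup∘tabulate _

  app-idMap : (x : Fin n) → app idMap x ≡ x
  app-idMap = lookup∘tabulate _

  Map-ext : {f g : Map n} → (∀ x → app f x ≡ app g x) → f ≡ g
  Map-ext {f} {g} f≗g = begin
    f                   ≡⟨ tabulate∘lookup f ⟨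
    tabulate (lookup f) ≡⟨ tabulate-cong f≗g ⟩
    tabulate (lookup g) ≡⟨ tabulate∘lookup g ⟩
    g                   ∎
    where open ≡-Reasoning

  ⊙-identityˡ : (f : Map n) → idMap ⊙ f ≡ f
  ⊙-identityˡ f = Map-ext λ x → trans (app-⊙ idMap f x) (app-idMap (app f x))

  ⊙-identityʳ : (f : Map n) → f ⊙ idMap ≡ f
  ⊙-identityʳ f = Map-ext λ x → trans (app-⊙ f idMap x) (cong (app f) (app-idMap x))

  InverseOf⇒inverseˡ : (f g : Map n) → InverseOf g f → g ⊙ f ≡ idMap
  InverseOf⇒inverseˡ f g g∘f = Map-ext λ x →
    trans (app-⊙ g f x) (trans (proj₁ (g∘f x)) (sym (app-idMap x)))

  ⊙-cancelˡ : (f g : Map n) → InverseOf g f → (h : Map n) → f ⊙ (g ⊙ h) ≡ h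
  ⊙-cancelˡ f g g∘f h = Map-ext λ x → begin
    app (f ⊙ (g ⊙ h)) x     ≡⟨ app-⊙ f (g ⊙ h) x ⟩
    app f (app (g ⊙ h) x)   ≡⟨ cong (app f) (app-⊙ g h x) ⟩
    app f (app g (app h x)) ≡⟨ proj₂ (g∘f (app h x)) ⟩
    app h x                 ∎
    where open ≡-Reasoning

  preimage : Map n → Fin n → Fin n
  preimage f y with any? (λ x → app f x ≟ y)
  ... | yes (x , _) = x
  ... | no _ = y

  preimage-correct : (f : Map n) (y : Fin n) → ∃ (λ x → app f x ≡ y) → app f (preimage f y) ≡ y
  preimage-correct f y hit with any? (λ x → app f x ≟ y)
  ... | yes (_ , fx≡y) = fx≡y
  ... | no none = ⊥-elim (none hit)

  inverse : Map n → Map n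
  inverse f = tabulate (preimage f)

  inverse-InverseOf : {f : Map n} → (∀ {x y} → app f x ≡ app f y → x ≡ y) →
                      (∀ y → ∃ λ x → app f x ≡ y) → InverseOf (inverse f) f
  inverse-InverseOf {f} injective surjective x = injective (section (app f x)) , section x
    where
    section : ∀ y → app f (app (inverse f) y) ≡ y
    section y = trans (cong (app f) (lookup∘tabulate (preimage f) y))
                      (preimage-correct f y (surjective y))

  iterMap : Map n → ℕ → Map n
  iterMap f zero = idMap
  iterMap f (suc k) = f ⊙ iterMap f k

  app-iterMap : (f : Map n) (k : ℕ) (x : Fin n) → app (iterMap f k) x ≡ iter f k x
  app-iterMap f zero x = app-idMap x
  app-iterMap f (suc k) x = trans (app-⊙ f (iterMap f k) x) (cong (app f) (app-iterMap f k x))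

∈-─ : {A : Set} {x y : A} {xs : List A} → y ∈ xs → y ≢ x → (x∈xs : x ∈ xs) → y ∈ (xs ─ x∈xs)
∈-─ (here y≡z) y≢x (here x≡z) = ⊥-elim (y≢x (trans y≡z (sym x≡z)))
∈-─ (there y∈xs) _ (here _) = y∈xs
∈-─ (here y≡z) _ (there _) = here y≡z
∈-─ (there y∈xs) y≢x (there x∈xs) = there (∈-─ y∈xs y≢x x∈xs)

module _ {A B : Set} where

  length-≤-injection : (φ : A → B) {xs : List A} {ys : List B} → Unique xs →
    (∀ {x} → x ∈ xs → φ x ∈ ys) →
    (∀ {x y} → x ∈ xs → y ∈ xs → φ x ≡ φ y → x ≡ y) →
    length xs ≤ length ys
  length-≤-injection φ {[]} _ _ _ = z≤n
  length-≤-injection φ {x ∷ xs} {ys} (x∉xs ∷ xs!) into injective =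
    subst (suc (length xs) ≤_) (sym (length-removeAt′ ys (index φx∈ys)))
      (s≤s (length-≤-injection φ xs! into′ (λ p q → injective (there p) (there q))))
    where
    φx∈ys = into (here refl)
    into′ : ∀ {y} → y ∈ xs → φ y ∈ (ys ─ φx∈ys)
    into′ y∈xs = ∈-─ (into (there y∈xs))
      (λ φy≡φx → lookupᴬ x∉xs y∈xs (sym (injective (there y∈xs) (here refl) φy≡φx))) φx∈ys

  length-cartesianProduct : (xs : List A) (ys : List B) →
                            length (cartesianProduct xs ys) ≡ length xs * length ys
  length-cartesianProduct [] ys = refl
  length-cartesianProduct (x ∷ xs) ys = begin
    length (map (x ,_) ys ++ cartesianProduct xs ys)
      ≡⟨ length-++ (map (x ,_) ys) ⟩
    length (map (x ,_) ys) + length (cartesianProduct xs ys)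
      ≡⟨ cong₂ _+_ (length-map (x ,_) ys) (length-cartesianProduct xs ys) ⟩
    length ys + length xs * length ys ∎
    where open ≡-Reasoning

module MapGroup {n : ℕ} {G K : Map n → Set}
  (G-idMap : G idMap)
  (G-⊙ : ∀ {f g} → G f → G g → G (f ⊙ g))
  (G-InverseOf : ∀ {f g} → G f → InverseOf g f → G g)
  (G-inverse : ∀ {f} → G f → InverseOf (inverse f) f)
  (h : Map n → Map n)
  (h-idMap : h idMap ≡ idMap)
  (h-⊙ : ∀ {f g} → G f → G g → h (f ⊙ g) ≡ h f ⊙ h g)
  (K⇔kernel : ∀ {f} → K f ⇔ (G f × h f ≡ idMap)) where

  open ≡-Reasoning

  private
    K-intro : ∀ {f} → G f → h f ≡ idMap → K f
    K-intro Gf hf≡id = from K⇔kernel (Gf , hf≡id)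

    K-G : ∀ {f} → K f → G f
    K-G = proj₁ ∘ to K⇔kernel

    K-h : ∀ {f} → K f → h f ≡ idMap
    K-h = proj₂ ∘ to K⇔kernel

  h-InverseOf : ∀ {f g} → G f → InverseOf g f → h g ⊙ h f ≡ idMap
  h-InverseOf {f} {g} Gf g∘f = begin
    h g ⊙ h f ≡⟨ h-⊙ (G-InverseOf Gf g∘f) Gf ⟨
    h (g ⊙ f) ≡⟨ cong h (InverseOf⇒inverseˡ f g g∘f) ⟩
    h idMap   ≡⟨ h-idMap ⟩
    idMap     ∎

  kernel-isNormalSubgroup : IsNormalSubgroup G K
  kernel-isNormalSubgroup = (λ _ → K-G) , K-intro G-idMap h-idMap , K-⊙ , K-InverseOf , K-conjugate
    where
    K-⊙ : ∀ f g → K f → K g → K (f ⊙ g)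
    K-⊙ f g Kf Kg = K-intro (G-⊙ (K-G Kf) (K-G Kg)) (begin
      h (f ⊙ g)     ≡⟨ h-⊙ (K-G Kf) (K-G Kg) ⟩
      h f ⊙ h g     ≡⟨ cong₂ _⊙_ (K-h Kf) (K-h Kg) ⟩
      idMap ⊙ idMap ≡⟨ ⊙-identityˡ idMap ⟩
      idMap         ∎)

    K-InverseOf : ∀ f g → K f → InverseOf g f → K g
    K-InverseOf f g Kf g∘f = K-intro (G-InverseOf (K-G Kf) g∘f) (begin
      h g         ≡⟨ ⊙-identityʳ (h g) ⟨
      h g ⊙ idMap ≡⟨ cong (h g ⊙_) (K-h Kf) ⟨
      h g ⊙ h f   ≡⟨ h-InverseOf (K-G Kf) g∘f ⟩
      idMap       ∎)

    K-conjugate : ∀ f g k → G f → InverseOf g f → K k → K (f ⊙ (k ⊙ g))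
    K-conjugate f g k Gf g∘f Kk = K-intro (G-⊙ Gf (G-⊙ (K-G Kk) Gg)) (begin
      h (f ⊙ (k ⊙ g))     ≡⟨ h-⊙ Gf (G-⊙ (K-G Kk) Gg) ⟩
      h f ⊙ h (k ⊙ g)     ≡⟨ cong (h f ⊙_) (h-⊙ (K-G Kk) Gg) ⟩
      h f ⊙ (h k ⊙ h g)   ≡⟨ cong (λ u → h f ⊙ (u ⊙ h g)) (K-h Kk) ⟩
      h f ⊙ (idMap ⊙ h g) ≡⟨ cong (h f ⊙_) (⊙-identityˡ (h g)) ⟩
      h f ⊙ h g           ≡⟨ h-InverseOf Gg (swap ∘ g∘f) ⟩
      idMap               ∎)
      where Gg = G-InverseOf Gf g∘f

  same-image⇒kernel : ∀ {f g} → G f → G g → h f ≡ h g → K (inverse f ⊙ g)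
  same-image⇒kernel {f} {g} Gf Gg hf≡hg = K-intro (G-⊙ Gf⁻¹ Gg) (begin
    h (inverse f ⊙ g)   ≡⟨ h-⊙ Gf⁻¹ Gg ⟩
    h (inverse f) ⊙ h g ≡⟨ cong (h (inverse f) ⊙_) hf≡hg ⟨
    h (inverse f) ⊙ h f ≡⟨ h-InverseOf Gf (G-inverse Gf) ⟩
    idMap               ∎)
    where Gf⁻¹ = G-InverseOf Gf (G-inverse Gf)

  same-image⇔coset : ∀ {f g} → G f → G g →
                     (h f ≡ h g) ⇔ Σ (Map n) (λ κ → K κ × (g ≡ (f ⊙ κ)))
  same-image⇔coset {f} {g} Gf Gg = mk⇔
    (λ hf≡hg → inverse f ⊙ g , same-image⇒kernel Gf Gg hf≡hg
             , sym (⊙-cancelˡ f (inverse f) (G-inverse Gf) g))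
    λ { (κ , Kκ , refl) → sym (begin
          h (f ⊙ κ)   ≡⟨ h-⊙ Gf (K-G Kκ) ⟩
          h f ⊙ h κ   ≡⟨ cong (h f ⊙_) (K-h Kκ) ⟩
          h f ⊙ idMap ≡⟨ ⊙-identityʳ (h f) ⟩
          h f         ∎) }

  -- Φ ↦ (h Φ, ρ⁻¹ ∘ Φ), where ρ is a fixed element of G in the fibre over h Φ, is injective.
  size-≤-image*kernel : {B C : Map n → Set} → (∀ {f} → G f → B (h f)) → (∀ {κ} → K κ → C κ) →
    ∀ a b c → HasSizeM G a → HasSizeM B b → HasSizeM C c → a ≤ b * c
  size-≤-image*kernel h-into K⊆C _ _ _
    (gs , gs! , refl , ∈gs) (bs , _ , refl , ∈bs) (cs , _ , refl , ∈cs) =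
    subst (length gs ≤_) (length-cartesianProduct bs cs)
      (length-≤-injection split gs! split-into split-injective)
    where
    G-of : ∀ {f} → f ∈ gs → G f
    G-of {f} = to (∈gs f)

    fibreElement : Map n → Map n
    fibreElement u with anyᴸ? (λ g → ≡-dec _≟_ (h g) u) gs
    ... | yes hit = proj₁ (find hit)
    ... | no _ = u

    fibreElement-correct : ∀ {f} → f ∈ gs → fibreElement (h f) ∈ gs × h (fibreElement (h f)) ≡ h f
    fibreElement-correct {f} f∈gs with anyᴸ? (λ g → ≡-dec _≟_ (h g) (h f)) gs
    ... | yes hit = proj₂ (find hit)
    ... | no miss = ⊥-elim (miss (mapᴬ (λ f≡g → cong h (sym f≡g)) f∈gs))

    split : Map n → Map n × Map n
    split f = h f , inverse (fibreElement (h f)) ⊙ f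

    split-into : ∀ {f} → f ∈ gs → split f ∈ cartesianProduct bs cs
    split-into {f} f∈gs =
      let ρ∈gs , hρ≡hf = fibreElement-correct f∈gs in
      ∈-cartesianProduct⁺ (from (∈bs _) (h-into (G-of f∈gs)))
        (from (∈cs _) (K⊆C (same-image⇒kernel (G-of ρ∈gs) (G-of f∈gs) hρ≡hf)))

    split-injective : ∀ {f f′} → f ∈ gs → f′ ∈ gs → split f ≡ split f′ → f ≡ f′
    split-injective {f} {f′} f∈gs f′∈gs e = begin
      f                                      ≡⟨ cancel f∈gs ⟨
      fibreElement (h f) ⊙ proj₂ (split f)
        ≡⟨ cong₂ (λ u v → fibreElement u ⊙ v) (cong proj₁ e) (cong proj₂ e) ⟩
      fibreElement (h f′) ⊙ proj₂ (split f′) ≡⟨ cancel f′∈gs ⟩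
      f′                                     ∎
      where
      cancel : ∀ {g} → g ∈ gs → fibreElement (h g) ⊙ proj₂ (split g) ≡ g
      cancel {g} g∈gs = ⊙-cancelˡ (fibreElement (h g)) (inverse (fibreElement (h g)))
        (G-inverse (G-of (proj₁ (fibreElement-correct g∈gs)))) g

module AutonomousSets (U : FinPoset) where

  private
    X : Set
    X = Fin (N U)

    _⊑_ : X → X → Set
    _⊑_ = _≼_ U

  autonomous-∪ : ∀ {S : X → Set} {A B : BSub (N U)} {y} → Autonomous U S A → Autonomous U S B →
                 T (A y) → T (B y) → Autonomous U S (λ w → A w ∨ B w)
  autonomous-∪ {S} {A} {B} {y} (A⊆S , _ , condA) (B⊆S , _ , condB) y∈A y∈B =
      (λ w w∈ → [ A⊆S w , B⊆S w ]′ (split w w∈))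
    , (y , from T-∨ (inj₁ y∈A))
    , λ z Sz z∉ →
        let z∉A = z∉ ∘ from T-∨ ∘ inj₁
            z∉B = z∉ ∘ from T-∨ ∘ inj₂
        in uniform (Lt U z) (proj₁ (condA z Sz z∉A)) (proj₁ (condB z Sz z∉B))
         , uniform (λ a → Lt U a z) (proj₂ (condA z Sz z∉A)) (proj₂ (condB z Sz z∉B))
    where
    split : ∀ w → T (A w ∨ B w) → T (A w) ⊎ T (B w)
    split w = to (T-∨ {A w} {B w})

    -- the common element y carries the relation from one of A, B to the other
    uniform : (R : X → Set) →
      ((Σ X λ a → T (A a) × R a) → ∀ a → T (A a) → R a) →
      ((Σ X λ b → T (B b) × R b) → ∀ b → T (B b) → R b) →
      (Σ X λ c → T (A c ∨ B c) × R c) → ∀ c → T (A c ∨ B c) → R c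
    uniform R allA allB (c , c∈ , Rc) c′ c′∈ =
      [ allA (y , y∈A , Ry) c′ , allB (y , y∈B , Ry) c′ ]′ (split c′ c′∈)
      where
      Ry : R y
      Ry = [ (λ c∈A → allA (c , c∈A , Rc) y y∈A) , (λ c∈B → allB (c , c∈B , Rc) y y∈B) ]′
             (split c c∈)

  autonomous-⊑-uniform : ∀ {S : X → Set} {A : BSub (N U)} {v a b} → Autonomous U S A →
    S v → ¬ T (A v) → T (A a) → T (A b) → (a ⊑ v ⇔ b ⊑ v) × (v ⊑ a ⇔ v ⊑ b)
  autonomous-⊑-uniform {S} {A} {v} (_ , _ , cond) Sv v∉A a∈A b∈A =
    mk⇔ (below a∈A b∈A) (below b∈A a∈A) , mk⇔ (above a∈A b∈A) (above b∈A a∈A)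
    where
    ≢v : ∀ {c} → T (A c) → c ≢ v
    ≢v c∈A refl = v∉A c∈A

    below : ∀ {c d} → T (A c) → T (A d) → c ⊑ v → d ⊑ v
    below {c} {d} c∈A d∈A c⊑v = proj₁ (proj₂ (cond v Sv v∉A) (c , c∈A , c⊑v , ≢v c∈A) d d∈A)

    above : ∀ {c d} → T (A c) → T (A d) → v ⊑ c → v ⊑ d
    above {c} {d} c∈A d∈A v⊑c = proj₁ (proj₁ (cond v Sv v∉A) (c , c∈A , v⊑c , ≢v c∈A ∘ sym) d d∈A)

module BlockAutomorphisms (U : FinPoset) (blk : Fin (N U) → ℕ) where

  private
    X : Set
    X = Fin (N U)

    _⊑_ : X → X → Set
    _⊑_ = _≼_ U

  record BlockAut (φ φ⁻¹ : Map (N U)) : Set where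
    field
      inverseˡ : ∀ x → app φ⁻¹ (app φ x) ≡ x
      inverseʳ : ∀ x → app φ (app φ⁻¹ x) ≡ x
      blk-pres : ∀ x → blk (app φ x) ≡ blk x
      mono     : ∀ {x y} → x ⊑ y → app φ x ⊑ app φ y
      reflects : ∀ {x y} → app φ x ⊑ app φ y → x ⊑ y

    injective : ∀ {x y} → app φ x ≡ app φ y → x ≡ y
    injective {x} {y} φx≡φy = trans (sym (inverseˡ x)) (trans (cong (app φ⁻¹) φx≡φy) (inverseˡ y))

    ⊑-iff : ∀ {x y} → x ⊑ y ⇔ app φ x ⊑ app φ y
    ⊑-iff = mk⇔ mono reflects

    Lt-pres : ∀ {x y} → Lt U x y → Lt U (app φ x) (app φ y)
    Lt-pres (x⊑y , x≢y) = mono x⊑y , x≢y ∘ injective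

  open BlockAut

  BlockAut-sym : ∀ {φ φ⁻¹} → BlockAut φ φ⁻¹ → BlockAut φ⁻¹ φ
  BlockAut-sym {φ} {φ⁻¹} I = record
    { inverseˡ = inverseʳ I
    ; inverseʳ = inverseˡ I
    ; blk-pres = λ x → trans (sym (blk-pres I (app φ⁻¹ x))) (cong blk (inverseʳ I x))
    ; mono     = λ {x} {y} p → reflects I (subst₂ _⊑_ (sym (inverseʳ I x)) (sym (inverseʳ I y)) p)
    ; reflects = λ {x} {y} p → subst₂ _⊑_ (inverseʳ I x) (inverseʳ I y) (mono I p)
    }

  BlockAut-⊙ : ∀ {f f⁻¹ g g⁻¹} → BlockAut f f⁻¹ → BlockAut g g⁻¹ → BlockAut (f ⊙ g) (g⁻¹ ⊙ f⁻¹)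
  BlockAut-⊙ {f} {f⁻¹} {g} {g⁻¹} I J = record
    { inverseˡ = λ x → begin
        app (g⁻¹ ⊙ f⁻¹) (app (f ⊙ g) x)     ≡⟨ app-⊙ g⁻¹ f⁻¹ _ ⟩
        app g⁻¹ (app f⁻¹ (app (f ⊙ g) x))   ≡⟨ cong (app g⁻¹ ∘ app f⁻¹) (app-⊙ f g x) ⟩
        app g⁻¹ (app f⁻¹ (app f (app g x))) ≡⟨ cong (app g⁻¹) (inverseˡ I _) ⟩
        app g⁻¹ (app g x)                   ≡⟨ inverseˡ J x ⟩
        x                                   ∎
    ; inverseʳ = λ x → begin
        app (f ⊙ g) (app (g⁻¹ ⊙ f⁻¹) x)     ≡⟨ app-⊙ f g _ ⟩
        app f (app g (app (g⁻¹ ⊙ f⁻¹) x))   ≡⟨ cong (app f ∘ app g) (app-⊙ g⁻¹ f⁻¹ x) ⟩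
        app f (app g (app g⁻¹ (app f⁻¹ x))) ≡⟨ cong (app f) (inverseʳ J _) ⟩
        app f (app f⁻¹ x)                   ≡⟨ inverseʳ I x ⟩
        x                                   ∎
    ; blk-pres = λ x → trans (cong blk (app-⊙ f g x)) (trans (blk-pres I _) (blk-pres J x))
    ; mono     = λ {x} {y} p → subst₂ _⊑_ (sym (app-⊙ f g x)) (sym (app-⊙ f g y)) (mono I (mono J p))
    ; reflects = λ {x} {y} p → reflects J (reflects I (subst₂ _⊑_ (app-⊙ f g x) (app-⊙ f g y) p))
    }
    where open ≡-Reasoning

  BlockAut-idMap : BlockAut idMap idMap
  BlockAut-idMap = record
    { inverseˡ = λ x → trans (app-idMap _) (app-idMap x)
    ; inverseʳ = λ x → trans (app-idMap _) (app-idMap x)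
    ; blk-pres = λ x → cong blk (app-idMap x)
    ; mono     = λ {x} {y} → subst₂ _⊑_ (sym (app-idMap x)) (sym (app-idMap y))
    ; reflects = λ {x} {y} → subst₂ _⊑_ (app-idMap x) (app-idMap y)
    }

  iter-blk : ∀ {φ} → (∀ x → blk (app φ x) ≡ blk x) → ∀ k x → blk (iter φ k x) ≡ blk x
  iter-blk pres zero x = refl
  iter-blk {φ} pres (suc k) x = trans (pres (iter φ k x)) (iter-blk pres k x)

  BlockAut⇒AutD : ∀ {φ φ⁻¹} → BlockAut φ φ⁻¹ → AutD U Full (SameD U blk) φ
  BlockAut⇒AutD {φ} {φ⁻¹} I =
      ( (λ _ _ → tt)
      , (λ _ _ _ _ → injective I)
      , (λ y _ → app φ⁻¹ y , tt , inverseʳ I y)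
      , (λ _ _ _ _ → ⊑-iff I)
      , (λ _ ∉Full → ⊥-elim (∉Full tt)) )
    , λ k x _ → iter-blk (blk-pres I) k x

  AutD⇒InverseOf : ∀ {f} → AutD U Full (SameD U blk) f → InverseOf (inverse f) f
  AutD⇒InverseOf ((_ , injective , surjective , _ , _) , _) =
    inverse-InverseOf (injective _ _ tt tt) (λ y → let x , _ , fx≡y = surjective y tt in x , fx≡y)

  InverseOf⇒BlockAut : ∀ {f g} → AutD U Full (SameD U blk) f → InverseOf g f → BlockAut f g
  InverseOf⇒BlockAut ((_ , _ , _ , ⊑⇔ , _) , blocks) g∘f = record
    { inverseˡ = proj₁ ∘ g∘f
    ; inverseʳ = proj₂ ∘ g∘f
    ; blk-pres = λ x → blocks 1 x tt
    ; mono     = to (⊑⇔ _ _ tt tt)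
    ; reflects = from (⊑⇔ _ _ tt tt)
    }

  AutD⇒BlockAut : ∀ {f} → AutD U Full (SameD U blk) f → BlockAut f (inverse f)
  AutD⇒BlockAut Gf = InverseOf⇒BlockAut Gf (AutD⇒InverseOf Gf)

  AutD-⊙ : ∀ {f g} → AutD U Full (SameD U blk) f → AutD U Full (SameD U blk) g →
           AutD U Full (SameD U blk) (f ⊙ g)
  AutD-⊙ Gf Gg = BlockAut⇒AutD (BlockAut-⊙ (AutD⇒BlockAut Gf) (AutD⇒BlockAut Gg))

  AutD-InverseOf : ∀ {f g} → AutD U Full (SameD U blk) f → InverseOf g f → AutD U Full (SameD U blk) g
  AutD-InverseOf Gf g∘f = BlockAut⇒AutD (BlockAut-sym (InverseOf⇒BlockAut Gf g∘f))

  autonomous-image : ∀ {φ φ⁻¹} {S : X → Set} {A : BSub (N U)} → BlockAut φ φ⁻¹ →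
    (∀ {x} → S x → S (app φ x)) → (∀ {x} → S x → S (app φ⁻¹ x)) →
    Autonomous U S A → Autonomous U S (A ∘ app φ⁻¹)
  autonomous-image {φ} {φ⁻¹} {S} {A} I S-φ S-φ⁻¹ (A⊆S , (a , a∈A) , cond) =
      (λ x x∈ → subst S (inverseʳ I x) (S-φ (A⊆S _ x∈)))
    , (app φ a , subst (T ∘ A) (sym (inverseˡ I a)) a∈A)
    , λ z Sz z∉ → let below , above = cond (app φ⁻¹ z) (S-φ⁻¹ Sz) z∉ in
        (λ (c , c∈ , z<c) d d∈ → back (below (app φ⁻¹ c , c∈ , Lt-pres J z<c) _ d∈))
      , (λ (c , c∈ , c<z) d d∈ → back (above (app φ⁻¹ c , c∈ , Lt-pres J c<z) _ d∈))
    where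
    J = BlockAut-sym I
    back : ∀ {x y} → Lt U (app φ⁻¹ x) (app φ⁻¹ y) → Lt U x y
    back {x} {y} p = subst₂ (Lt U) (inverseʳ I x) (inverseʳ I y) (Lt-pres I p)

module MaximalAutonomousAntichains (U : FinPoset) (blk : Fin (N U) → ℕ)
  (blocks-antichain : ∀ x y → blk x ≡ blk y → _≼_ U x y → x ≡ y)
  (s nn : ℕ) where

  open AutonomousSets U
  open BlockAutomorphisms U blk
  open BlockAut

  private
    X : Set
    X = Fin (N U)

    U′ : X → Set
    U′ = U' U blk s nn

    _~_ : X → X → Set
    _~_ = SameA U blk s nn

  antichain-in-block : ∀ {j} {A : BSub (N U)} → (∀ z → T (A z) → blk z ≡ j) → Antichain U A
  antichain-in-block A⊆Dj x y x∈ y∈ = blocks-antichain x y (trans (A⊆Dj x x∈) (sym (A⊆Dj y y∈)))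

  image-in-block : ∀ {φ φ⁻¹ j} {A : BSub (N U)} → BlockAut φ φ⁻¹ →
    (∀ z → T (A z) → blk z ≡ j) → ∀ z → T (A (app φ⁻¹ z)) → blk z ≡ j
  image-in-block I A⊆Dj z z∈ = trans (sym (blk-pres (BlockAut-sym I) z)) (A⊆Dj _ z∈)

  U′-image : ∀ {φ φ⁻¹} → BlockAut φ φ⁻¹ → ∀ {x} → U′ x → U′ (app φ x)
  U′-image I {x} = subst (_< nn) (sym (blk-pres I x))

  maxAutAC-image : ∀ {φ φ⁻¹ j} {A : BSub (N U)} → BlockAut φ φ⁻¹ →
    MaxAutAC U blk U′ j A → MaxAutAC U blk U′ j (A ∘ app φ⁻¹)
  maxAutAC-image {φ} {φ⁻¹} {j} {A} I (A⊆Dj , _ , A-aut , A-maximal) =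
      image-in-block I A⊆Dj
    , antichain-in-block (image-in-block I A⊆Dj)
    , autonomous-image I (U′-image I) (U′-image J) A-aut
    , maximal
    where
    J = BlockAut-sym I
    maximal : ∀ B → (∀ z → T (B z) → blk z ≡ j) → Antichain U B → Autonomous U U′ B →
              (∀ z → T (A (app φ⁻¹ z)) → T (B z)) → ∀ z → T (B z) → T (A (app φ⁻¹ z))
    maximal B B⊆Dj _ B-aut image⊆B z z∈B =
      A-maximal (B ∘ app φ) (image-in-block J B⊆Dj) (antichain-in-block (image-in-block J B⊆Dj))
        (autonomous-image J (U′-image J) (U′-image I) B-aut)
        (λ w w∈A → image⊆B (app φ w) (subst (T ∘ A) (sym (inverseˡ I w)) w∈A))
        (app φ⁻¹ z) (subst (T ∘ B) (sym (inverseʳ I z)) z∈B)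

  SameA-image : ∀ {φ φ⁻¹ x y} → BlockAut φ φ⁻¹ → x ~ y → app φ x ~ app φ y
  SameA-image {φ} {φ⁻¹} {x} {y} I (A , A-max , x∈A , y∈A) =
      A ∘ app φ⁻¹
    , subst (λ j → MaxAutAC U blk U′ j (A ∘ app φ⁻¹)) (sym (blk-pres I x)) (maxAutAC-image I A-max)
    , subst (T ∘ A) (sym (inverseˡ I x)) x∈A
    , subst (T ∘ A) (sym (inverseˡ I y)) y∈A

  SameA-blk : ∀ {x y} → x ~ y → blk y ≡ blk x
  SameA-blk {y = y} (_ , A-max , _ , y∈A) = proj₁ A-max y y∈A

  SameA-sym : ∀ {x y} → x ~ y → y ~ x
  SameA-sym x~y@(A , A-max , x∈A , y∈A) =
    A , subst (λ j → MaxAutAC U blk U′ j A) (sym (SameA-blk x~y)) A-max , y∈A , x∈A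

  -- A ∪ B is again an autonomous antichain in the block, so by maximality it lies in A.
  SameA-trans : ∀ {x y z} → x ~ y → y ~ z → x ~ z
  SameA-trans {x} {y} {z} (A , A-max@(A⊆Dx , _ , A-aut , A-maximal) , x∈A , y∈A)
                          (B , (B⊆Dy , _ , B-aut , _) , y∈B , z∈B) =
    A , A-max , x∈A ,
    A-maximal C C⊆Dx (antichain-in-block C⊆Dx) (autonomous-∪ A-aut B-aut y∈A y∈B)
      (λ w → from (T-∨ {A w} {B w}) ∘ inj₁) z (from (T-∨ {A z} {B z}) (inj₂ z∈B))
    where
    C : BSub (N U)
    C w = A w ∨ B w
    C⊆Dx : ∀ w → T (C w) → blk w ≡ blk x
    C⊆Dx w w∈C = [ A⊆Dx w , (λ w∈B → trans (B⊆Dy w w∈B) (A⊆Dx y y∈A)) ]′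
                   (to (T-∨ {A w} {B w}) w∈C)

module Restriction (U : FinPoset) (blk : Fin (N U) → ℕ)
  (blocks-antichain : ∀ x y → blk x ≡ blk y → _≼_ U x y → x ≡ y)
  (s nn : ℕ) (s<nn : s < nn)
  (rep : Fin (N U) → Fin (N U)) (rep-choice : IsRepChoice U blk s nn rep) where

  open AutonomousSets U
  open BlockAutomorphisms U blk
  open BlockAut
  open MaximalAutonomousAntichains U blk blocks-antichain s nn
  open ≡-Reasoning

  private
    X : Set
    X = Fin (N U)

    _⊑_ : X → X → Set
    _⊑_ = _≼_ U

    ⊑-refl : ∀ {x} → x ⊑ x
    ⊑-refl = IsPartialOrder.refl (isPartialOrder U)

    G : Map (N U) → Set
    G = AutD U Full (SameD U blk)

    K : Map (N U) → Set
    K = AutUDQ U blk s nn rep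

    Uₙ : X → Set
    Uₙ = Un U blk s nn rep

    Q′ : X → Set
    Q′ = Q U blk s nn

    _~_ : X → X → Set
    _~_ = SameA U blk s nn

    φₙ : Map (N U) → X → X
    φₙ = phiN U blk s nn rep

    φₙMap : Map (N U) → Map (N U)
    φₙMap = phiNMap U blk s nn rep

  Mid : X → Set
  Mid x = (s ≤ blk x) × (blk x < nn)

  rep-SameA : ∀ {x} → Mid x → x ~ rep x
  rep-SameA {x} (s≤ , <nn) = proj₁ (rep-choice x s≤ <nn)

  rep-cong : ∀ {x y} → Mid x → x ~ y → rep x ≡ rep y
  rep-cong {x} {y} (s≤ , <nn) x~y = sym (proj₂ (rep-choice x s≤ <nn) y x~y)

  Mid-resp-blk : ∀ {x y} → blk x ≡ blk y → Mid x → Mid y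
  Mid-resp-blk e (s≤ , <nn) = subst (s ≤_) e s≤ , subst (_< nn) e <nn

  Mid-rep : ∀ {x} → Mid x → Mid (rep x)
  Mid-rep m = Mid-resp-blk (sym (SameA-blk (rep-SameA m))) m

  rep-idem : ∀ {x} → Mid x → rep (rep x) ≡ rep x
  rep-idem m = sym (rep-cong m (rep-SameA m))

  Uₙ-rep : ∀ {x} → Mid x → Uₙ (rep x)
  Uₙ-rep m = inj₂ (proj₁ (Mid-rep m) , proj₂ (Mid-rep m) , rep-idem m)

  rep≡⇒SameA : ∀ {x y} → Mid x → Mid y → rep x ≡ rep y → x ~ y
  rep≡⇒SameA {y = y} mx my e =
    SameA-trans (rep-SameA mx) (subst (_~ y) (sym e) (SameA-sym (rep-SameA my)))

  Mid-image : ∀ {φ φ⁻¹ x} → BlockAut φ φ⁻¹ → Mid x → Mid (app φ x)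
  Mid-image {x = x} I = Mid-resp-blk (sym (blk-pres I x))

  rep-image : ∀ {φ φ⁻¹ x y} → BlockAut φ φ⁻¹ → Mid x → Mid y → rep x ≡ rep y →
              rep (app φ x) ≡ rep (app φ y)
  rep-image I mx my e = rep-cong (Mid-image I mx) (SameA-image I (rep≡⇒SameA mx my e))

  rep-image-rep : ∀ {φ φ⁻¹ x} → BlockAut φ φ⁻¹ → Mid x → rep (app φ (rep x)) ≡ rep (app φ x)
  rep-image-rep I m = rep-image I (Mid-rep m) m (rep-idem m)

  rep-image-injective : ∀ {φ φ⁻¹ x y} → BlockAut φ φ⁻¹ → Mid x → Mid y → rep x ≡ x → rep y ≡ y →
                        rep (app φ x) ≡ rep (app φ y) → x ≡ y
  rep-image-injective {φ} {φ⁻¹} {x} {y} I mx my x-rep y-rep e = begin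
    x                       ≡⟨ x-rep ⟨
    rep x                   ≡⟨ cong rep (inverseˡ I x) ⟨
    rep (app φ⁻¹ (app φ x)) ≡⟨ rep-image (BlockAut-sym I) (Mid-image I mx) (Mid-image I my) e ⟩
    rep (app φ⁻¹ (app φ y)) ≡⟨ cong rep (inverseˡ I y) ⟩
    rep y                   ≡⟨ y-rep ⟩
    y                       ∎

  rep-⊑-swap : ∀ {u v} → Mid u → blk v < nn → ¬ u ~ v →
               (u ⊑ v ⇔ rep u ⊑ v) × (v ⊑ u ⇔ v ⊑ rep u)
  rep-⊑-swap mu v<nn u≁v =
    let A , A-max , u∈A , ru∈A = rep-SameA mu in
    autonomous-⊑-uniform (proj₁ (proj₂ (proj₂ A-max))) v<nn
      (λ v∈A → u≁v (A , A-max , u∈A , v∈A)) u∈A ru∈A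

  rep-⊑-rep : ∀ {u w} → Mid u → Mid w → rep u ≢ rep w → u ⊑ w ⇔ rep u ⊑ rep w
  rep-⊑-rep mu mw ru≢rw =
    proj₂ (rep-⊑-swap mw (proj₂ (Mid-rep mu)) w≁ru)
      ⇔-∘ proj₁ (rep-⊑-swap mu (proj₂ mw) (ru≢rw ∘ rep-cong mu))
    where
    w≁ru : ¬ _ ~ _
    w≁ru w~ru = ru≢rw (trans (sym (rep-idem mu)) (sym (rep-cong mw w~ru)))

  lower-image : ∀ {φ φ⁻¹ x} → BlockAut φ φ⁻¹ → blk x < s → blk (app φ x) < s
  lower-image {x = x} I = subst (_< s) (sym (blk-pres I x))

  lower≢Mid : ∀ {x y} → blk x < s → Mid y → blk x ≢ blk y
  lower≢Mid x<s (s≤y , _) e = ≤⇒≯ s≤y (subst (_< s) e x<s)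

  lower≁Mid : ∀ {u v} → blk v < s → Mid u → ¬ u ~ v
  lower≁Mid v<s mu u~v = lower≢Mid v<s mu (SameA-blk u~v)

  lower-<nn : ∀ {x} → blk x < s → blk x < nn
  lower-<nn x<s = <-trans x<s s<nn

  ⊑-≡ : ∀ {a a′ b b′} → a ≡ a′ → b ≡ b′ → a ⊑ b ⇔ a′ ⊑ b′
  ⊑-≡ refl refl = mk⇔ (λ p → p) (λ p → p)

  representative? : ∀ x → Dec ((s ≤ blk x) × (blk x < nn) × (rep x ≡ x))
  representative? x = s ≤? blk x ×-dec (blk x <? nn ×-dec rep x ≟ x)

  Uₙ? : ∀ x → Dec (Uₙ x)
  Uₙ? x = blk x <? s ⊎-dec representative? x

  φₙ-lower : ∀ Φ {x} → blk x < s → φₙ Φ x ≡ app Φ x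
  φₙ-lower Φ {x} = if-does-yes (blk x <? s)

  φₙ-rep : ∀ Φ {x} → Mid x → rep x ≡ x → φₙ Φ x ≡ rep (app Φ x)
  φₙ-rep Φ {x} (s≤ , <nn) x-rep =
    trans (if-does-no (blk x <? s) (≤⇒≯ s≤)) (if-does-yes (representative? x) (s≤ , <nn , x-rep))

  φₙ-outside : ∀ Φ {x} → ¬ Uₙ x → φₙ Φ x ≡ x
  φₙ-outside Φ {x} x∉ =
    trans (if-does-no (blk x <? s) (x∉ ∘ inj₁)) (if-does-no (representative? x) (x∉ ∘ inj₂))

  app-φₙMap : ∀ Φ x → app (φₙMap Φ) x ≡ φₙ Φ x
  app-φₙMap Φ = lookup∘tabulate (φₙ Φ)

  fixes-Uₙ⇔φₙMap≡idMap : ∀ Φ → (∀ x → Uₙ x → φₙ Φ x ≡ x) ⇔ (φₙMap Φ ≡ idMap)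
  fixes-Uₙ⇔φₙMap≡idMap Φ = mk⇔
    (λ fixes → Map-ext λ x → trans (app-φₙMap Φ x) (trans (fixes′ fixes x) (sym (app-idMap x))))
    (λ e x _ → trans (sym (app-φₙMap Φ x)) (trans (cong (λ f → app f x) e) (app-idMap x)))
    where
    fixes′ : (∀ x → Uₙ x → φₙ Φ x ≡ x) → ∀ x → φₙ Φ x ≡ x
    fixes′ fixes x with Uₙ? x
    ... | yes x∈ = fixes x x∈
    ... | no x∉ = φₙ-outside Φ x∉

  K⇔kernel : ∀ {Φ} → K Φ ⇔ (G Φ × φₙMap Φ ≡ idMap)
  K⇔kernel {Φ} = mk⇔ (map₂ (to fixes⇔)) (map₂ (from fixes⇔))
    where fixes⇔ = fixes-Uₙ⇔φₙMap≡idMap Φ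

  φₙMap-idMap : φₙMap idMap ≡ idMap
  φₙMap-idMap = to (fixes-Uₙ⇔φₙMap≡idMap idMap) λ
    { x (inj₁ x<s) → trans (φₙ-lower idMap x<s) (app-idMap x)
    ; x (inj₂ (s≤ , <nn , x-rep)) →
        trans (φₙ-rep idMap (s≤ , <nn) x-rep) (trans (cong rep (app-idMap x)) x-rep) }

  φₙ-⊙ : ∀ {f g} → G f → G g → ∀ x → φₙ (f ⊙ g) x ≡ φₙ f (φₙ g x)
  φₙ-⊙ {f} {g} Gf Gg x with Uₙ? x
  ... | yes (inj₁ x<s) = begin
    φₙ (f ⊙ g) x    ≡⟨ φₙ-lower (f ⊙ g) x<s ⟩
    app (f ⊙ g) x   ≡⟨ app-⊙ f g x ⟩
    app f (app g x) ≡⟨ φₙ-lower f (lower-image (AutD⇒BlockAut Gg) x<s) ⟨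
    φₙ f (app g x)  ≡⟨ cong (φₙ f) (φₙ-lower g x<s) ⟨
    φₙ f (φₙ g x)   ∎
  ... | yes (inj₂ (s≤ , <nn , x-rep)) = begin
    φₙ (f ⊙ g) x                ≡⟨ φₙ-rep (f ⊙ g) (s≤ , <nn) x-rep ⟩
    rep (app (f ⊙ g) x)         ≡⟨ cong rep (app-⊙ f g x) ⟩
    rep (app f (app g x))       ≡⟨ rep-image-rep (AutD⇒BlockAut Gf) mgx ⟨
    rep (app f (rep (app g x))) ≡⟨ φₙ-rep f (Mid-rep mgx) (rep-idem mgx) ⟨
    φₙ f (rep (app g x))        ≡⟨ cong (φₙ f) (φₙ-rep g (s≤ , <nn) x-rep) ⟨
    φₙ f (φₙ g x)               ∎
    where mgx = Mid-image (AutD⇒BlockAut Gg) (s≤ , <nn)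
  ... | no x∉ = trans (φₙ-outside (f ⊙ g) x∉)
                  (sym (trans (cong (φₙ f) (φₙ-outside g x∉)) (φₙ-outside f x∉)))

  φₙMap-⊙ : ∀ {f g} → G f → G g → φₙMap (f ⊙ g) ≡ φₙMap f ⊙ φₙMap g
  φₙMap-⊙ {f} {g} Gf Gg = Map-ext λ x → begin
    app (φₙMap (f ⊙ g)) x             ≡⟨ app-φₙMap (f ⊙ g) x ⟩
    φₙ (f ⊙ g) x                      ≡⟨ φₙ-⊙ Gf Gg x ⟩
    φₙ f (φₙ g x)                     ≡⟨ app-φₙMap f _ ⟨
    app (φₙMap f) (φₙ g x)            ≡⟨ cong (app (φₙMap f)) (app-φₙMap g x) ⟨
    app (φₙMap f) (app (φₙMap g) x)   ≡⟨ app-⊙ (φₙMap f) (φₙMap g) x ⟨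
    app (φₙMap f ⊙ φₙMap g) x         ∎

  open MapGroup (BlockAut⇒AutD BlockAut-idMap) AutD-⊙ AutD-InverseOf AutD⇒InverseOf
                φₙMap φₙMap-idMap φₙMap-⊙ K⇔kernel public

  module _ {f : Map (N U)} (Gf : G f) where

    private
      I : BlockAut f (inverse f)
      I = AutD⇒BlockAut Gf

    φₙ-blk : ∀ x → blk (φₙ f x) ≡ blk x
    φₙ-blk x with Uₙ? x
    ... | yes (inj₁ x<s) = trans (cong blk (φₙ-lower f x<s)) (blk-pres I x)
    ... | yes (inj₂ (s≤ , <nn , x-rep)) = trans (cong blk (φₙ-rep f (s≤ , <nn) x-rep))
      (trans (SameA-blk (rep-SameA (Mid-image I (s≤ , <nn)))) (blk-pres I x))
    ... | no x∉ = cong blk (φₙ-outside f x∉)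

    φₙ-Uₙ : ∀ {x} → Uₙ x → Uₙ (φₙ f x)
    φₙ-Uₙ {x} (inj₁ x<s) = inj₁ (subst (_< s) (sym (φₙ-blk x)) x<s)
    φₙ-Uₙ (inj₂ (s≤ , <nn , x-rep)) =
      subst Uₙ (sym (φₙ-rep f (s≤ , <nn) x-rep)) (Uₙ-rep (Mid-image I (s≤ , <nn)))

    φₙ-injective : ∀ {x y} → Uₙ x → Uₙ y → φₙ f x ≡ φₙ f y → x ≡ y
    φₙ-injective (inj₁ x<s) (inj₁ y<s) e =
      injective I (trans (sym (φₙ-lower f x<s)) (trans e (φₙ-lower f y<s)))
    φₙ-injective {x} {y} (inj₁ x<s) (inj₂ (s≤ , <nn , _)) e =
      ⊥-elim (lower≢Mid x<s (s≤ , <nn) (trans (sym (φₙ-blk x)) (trans (cong blk e) (φₙ-blk y))))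
    φₙ-injective {x} {y} (inj₂ (s≤ , <nn , _)) (inj₁ y<s) e =
      ⊥-elim (lower≢Mid y<s (s≤ , <nn) (trans (sym (φₙ-blk y)) (trans (cong blk (sym e)) (φₙ-blk x))))
    φₙ-injective (inj₂ (s≤ , <nn , x-rep)) (inj₂ (s≤′ , <nn′ , y-rep)) e =
      rep-image-injective I (s≤ , <nn) (s≤′ , <nn′) x-rep y-rep
        (trans (sym (φₙ-rep f (s≤ , <nn) x-rep)) (trans e (φₙ-rep f (s≤′ , <nn′) y-rep)))

    φₙ-surjective : ∀ {y} → Uₙ y → Σ X λ x → Uₙ x × φₙ f x ≡ y
    φₙ-surjective {y} (inj₁ y<s) =
      app (inverse f) y , inj₁ x<s , trans (φₙ-lower f x<s) (inverseʳ I y)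
      where x<s = lower-image (BlockAut-sym I) y<s
    φₙ-surjective {y} (inj₂ (s≤ , <nn , y-rep)) = rep (app (inverse f) y) , Uₙ-rep m , (begin
      φₙ f (rep (app (inverse f) y))        ≡⟨ φₙ-rep f (Mid-rep m) (rep-idem m) ⟩
      rep (app f (rep (app (inverse f) y))) ≡⟨ rep-image-rep I m ⟩
      rep (app f (app (inverse f) y))       ≡⟨ cong rep (inverseʳ I y) ⟩
      rep y                                 ≡⟨ y-rep ⟩
      y                                     ∎)
      where m = Mid-image (BlockAut-sym I) (s≤ , <nn)

    φₙ-⊑ : ∀ {x y} → Uₙ x → Uₙ y → x ⊑ y ⇔ φₙ f x ⊑ φₙ f y
    φₙ-⊑ (inj₁ x<s) (inj₁ y<s) =
      ⊑-≡ (sym (φₙ-lower f x<s)) (sym (φₙ-lower f y<s)) ⇔-∘ ⊑-iff I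
    φₙ-⊑ (inj₁ x<s) (inj₂ (s≤ , <nn , y-rep)) =
      ⊑-≡ (sym (φₙ-lower f x<s)) (sym (φₙ-rep f (s≤ , <nn) y-rep))
        ⇔-∘ (proj₂ (rep-⊑-swap mfy (lower-<nn fx<s) (lower≁Mid fx<s mfy))
        ⇔-∘ ⊑-iff I)
      where
      fx<s = lower-image I x<s
      mfy = Mid-image I (s≤ , <nn)
    φₙ-⊑ (inj₂ (s≤ , <nn , x-rep)) (inj₁ y<s) =
      ⊑-≡ (sym (φₙ-rep f (s≤ , <nn) x-rep)) (sym (φₙ-lower f y<s))
        ⇔-∘ (proj₁ (rep-⊑-swap mfx (lower-<nn fy<s) (lower≁Mid fy<s mfx))
        ⇔-∘ ⊑-iff I)
      where
      fy<s = lower-image I y<s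
      mfx = Mid-image I (s≤ , <nn)
    φₙ-⊑ {x} {y} (inj₂ (s≤ , <nn , x-rep)) (inj₂ (s≤′ , <nn′ , y-rep))
      with rep (app f x) ≟ rep (app f y)
    ... | yes e = subst (λ w → x ⊑ w ⇔ φₙ f x ⊑ φₙ f w)
                    (rep-image-injective I (s≤ , <nn) (s≤′ , <nn′) x-rep y-rep e)
                    (mk⇔ (λ _ → ⊑-refl) (λ _ → ⊑-refl))
    ... | no ≢ = ⊑-≡ (sym (φₙ-rep f (s≤ , <nn) x-rep)) (sym (φₙ-rep f (s≤′ , <nn′) y-rep))
                   ⇔-∘ (rep-⊑-rep (Mid-image I (s≤ , <nn)) (Mid-image I (s≤′ , <nn′)) ≢
                   ⇔-∘ ⊑-iff I)

    φₙMap-AutD : AutD U Uₙ (SameDn U blk s nn rep) (φₙMap f)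
    φₙMap-AutD =
        ( (λ x x∈ → subst Uₙ (sym (app-φₙMap f x)) (φₙ-Uₙ x∈))
        , (λ x y x∈ y∈ e →
             φₙ-injective x∈ y∈ (trans (sym (app-φₙMap f x)) (trans e (app-φₙMap f y))))
        , (λ y y∈ → let x , x∈ , e = φₙ-surjective y∈ in x , x∈ , trans (app-φₙMap f x) e)
        , (λ x y x∈ y∈ → ⊑-≡ (sym (app-φₙMap f x)) (sym (app-φₙMap f y)) ⇔-∘ φₙ-⊑ x∈ y∈)
        , (λ x x∉ → trans (app-φₙMap f x) (φₙ-outside f x∉)) )
      , λ k x _ → iter-blk (λ z → trans (cong blk (app-φₙMap f z)) (φₙ-blk z)) k x

  private
    K-idMap : K idMap
    K-idMap = proj₁ (proj₂ kernel-isNormalSubgroup)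

    K-⊙ : ∀ f g → K f → K g → K (f ⊙ g)
    K-⊙ = proj₁ (proj₂ (proj₂ kernel-isNormalSubgroup))

    K-InverseOf : ∀ f g → K f → InverseOf g f → K g
    K-InverseOf = proj₁ (proj₂ (proj₂ (proj₂ kernel-isNormalSubgroup)))

    K⇒BlockAut : ∀ {κ} → K κ → BlockAut κ (inverse κ)
    K⇒BlockAut = AutD⇒BlockAut ∘ proj₁

  K-fixes-lower : ∀ {κ y} → K κ → blk y < s → app κ y ≡ y
  K-fixes-lower {κ} (_ , fixes) y<s = trans (sym (φₙ-lower κ y<s)) (fixes _ (inj₁ y<s))

  K-preserves-classes : ∀ {κ y} → K κ → Mid y → rep (app κ y) ≡ rep y
  K-preserves-classes {κ} {y} Kκ@(_ , fixes) m = begin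
    rep (app κ y)       ≡⟨ rep-image-rep (K⇒BlockAut Kκ) m ⟨
    rep (app κ (rep y)) ≡⟨ φₙ-rep κ (Mid-rep m) (rep-idem m) ⟨
    φₙ κ (rep y)        ≡⟨ fixes (rep y) (Uₙ-rep m) ⟩
    rep y               ∎

  K⇒IsAut-Q : ∀ {κ} → K κ → IsAut U Q′ κ
  K⇒IsAut-Q {κ} Kκ =
      (λ x s≤ → subst (s ≤_) (sym (blk-pres I x)) s≤)
    , (λ _ _ _ _ → injective I)
    , (λ y s≤ → app (inverse κ) y , subst (s ≤_) (sym (blk-pres (BlockAut-sym I) y)) s≤ , inverseʳ I y)
    , (λ _ _ _ _ → ⊑-iff I)
    , (λ x x∉Q → K-fixes-lower Kκ (≰⇒> x∉Q))
    where I = K⇒BlockAut Kκ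

  K⇒SameE : ∀ {κ y} → K κ → Q′ y → SameE U blk s nn (app κ y) y
  K⇒SameE {κ} {y} Kκ s≤ with blk y <? nn
  ... | yes <nn =
    let mκy = Mid-image (K⇒BlockAut Kκ) (s≤ , <nn) in
    blk-pres (K⇒BlockAut Kκ) y ,
    inj₁ (proj₁ mκy , proj₂ mκy , rep≡⇒SameA mκy (s≤ , <nn) (K-preserves-classes Kκ (s≤ , <nn)))
  ... | no ≮nn =
    blk-pres (K⇒BlockAut Kκ) y , inj₂ (subst (nn ≤_) (sym (blk-pres (K⇒BlockAut Kκ) y)) (≮⇒≥ ≮nn))

  K-iterMap : ∀ {κ} → K κ → ∀ k → K (iterMap κ k)
  K-iterMap Kκ zero = K-idMap
  K-iterMap {κ} Kκ (suc k) = K-⊙ κ (iterMap κ k) Kκ (K-iterMap Kκ k)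

  K⇒AutD-SameE : ∀ {κ} → K κ → AutD U Q′ (SameE U blk s nn) κ
  K⇒AutD-SameE {κ} Kκ = K⇒IsAut-Q Kκ , λ k y Qy →
    subst (λ z → SameE U blk s nn z y) (app-iterMap κ k y) (K⇒SameE (K-iterMap Kκ k) Qy)

  K⇒AutD-SameDQ : ∀ {κ} → K κ → AutD U Q′ (SameDQ U blk s nn) κ
  K⇒AutD-SameDQ {κ} Kκ = K⇒IsAut-Q Kκ , λ k x _ →
    let κᵏ = iterMap κ k
        Kκᵏ = K-iterMap Kκ k
        κᵏ⁻¹∘κᵏ = AutD⇒InverseOf (proj₁ Kκᵏ)
    in inverse κᵏ , K⇒AutD-SameE (K-InverseOf κᵏ (inverse κᵏ) Kκᵏ κᵏ⁻¹∘κᵏ)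
     , trans (cong (app (inverse κᵏ)) (sym (app-iterMap κ k x))) (proj₁ (κᵏ⁻¹∘κᵏ x))

theorem4p12 :
    (U : FinPoset) (m : ℕ) (blk : Fin (N U) → ℕ) →
    IsDictated U blk m → Tight U blk → Flexible U blk → 3 ≤ m →
    (n s t r : ℕ) → 3 ≤ n → n ≤ m → 1 ≤ s → s < n → s ≤ t → n < r →
    -- (i) {D_1,…,D_{n-1}} is a connected component of O(U,D) - D_n
    ((∀ i j → 1 ≤ i → i < n → 1 ≤ j → j < n → Star (EdgeWithout U blk m n) i j) ×
     (∀ i j → 1 ≤ i → i < n → 1 ≤ j → j ≤ m → j ≢ n → DI U blk i j → j < n)) →
    -- (ii) the orbits directly interdependent with D_n are D_s..D_{n-1}, D_r..D_m
    (∀ j → 1 ≤ j → j ≤ m → j ≢ n → DI U blk n j ⇔ (((s ≤ j) × (j < n)) ⊎ (r ≤ j))) →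
    -- (iii) D_j (j < n) contains a nontrivial U'-autonomous antichain iff t ≤ j
    (∀ j → 1 ≤ j → j < n →
      (Σ (BSub (N U)) (λ A → (∀ z → T (A z) → blk z ≡ j) × Antichain U A ×
          Autonomous U (U' U blk s n) A × NonTrivial U (U' U blk s n) A))
      ⇔ (t ≤ j)) →
    (rep : Fin (N U) → Fin (N U)) → IsRepChoice U blk s n rep →
    IsNormalSubgroup (AutD U Full (SameD U blk)) (AutUDQ U blk s n rep) ×
    (Σ (Map (N U) → Map (N U)) λ h →
      (∀ f → AutD U Full (SameD U blk) f →
         AutD U (Un U blk s n rep) (SameDn U blk s n rep) (h f)) ×
      (∀ f g → AutD U Full (SameD U blk) f → AutD U Full (SameD U blk) g →
         h (f ⊙ g) ≡ (h f ⊙ h g)) ×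
      (∀ f g → AutD U Full (SameD U blk) f → AutD U Full (SameD U blk) g →
         (h f ≡ h g) ⇔ Σ (Map (N U)) (λ κ → AutUDQ U blk s n rep κ × (g ≡ (f ⊙ κ))))) ×
    (∀ a b c → HasSizeM (AutD U Full (SameD U blk)) a →
       HasSizeM (AutD U (Un U blk s n rep) (SameDn U blk s n rep)) b →
       HasSizeM (AutD U (Q U blk s n) (SameDQ U blk s n)) c →
       a ≤ b * c)
theorem4p12 U _ blk (_ , _ , blocks-antichain) _ _ _ n s _ _ _ _ _ s<n _ _ _ _ _ rep rep-choice =
    kernel-isNormalSubgroup
  , ( phiNMap U blk s n rep
    , (λ _ → φₙMap-AutD)
    , (λ _ _ → φₙMap-⊙)
    , (λ _ _ → same-image⇔coset) )
  , size-≤-image*kernel φₙMap-AutD K⇒AutD-SameDQ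
  where open Restriction U blk blocks-antichain s n s<n rep rep-choice
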